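{- Let $p$ be a prime with $p \equiv 7$ or $23 \pmod{40}$. Then there is no triple $(N,M,e) \in \mathbb{Z}^3$ with $M \neq 0$, $e \neq 0$ satisfying $N^2 = 5pM^4 - e^4$ together with $\gcd(N,e)=\gcd(M,e)=\gcd(5p,e)=\gcd(-1,M)=\gcd(M,N)=1$. -}

module Defs where

-- Reduce mod 8. Since 5p ≡ 3 (mod 8), fourth powers are ≡ 0 or 1 (mod 8)
-- according to parity, and squares are ≡ 0, 1 or 4, the equation
-- N² + e⁴ = 5pM⁴ forces both e and M to be even, contradicting gcd(M, e) = 1.
module Submission where

open import Defs
open import Algebra.Bundles using (AbelianGroup)
open import Data.Nat as ℕ using (ℕ; _<_; NonZero)
import Data.Nat.Properties as ℕ
open import Data.Nat.DivMod
  using (_%_; %-distribˡ-+; %-distribˡ-*; m%n%n≡m%n; m%n<n; m∣n⇒o%n%m≡o%m)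
open import Data.Nat.Divisibility using (_∣_; divides; m%n≡0⇒n∣m)
open import Data.Nat.Coprimality using (gcd≡1⇒coprime)
open import Data.Nat.Primality using (Prime)
open import Data.Integer using (ℤ; +_; -[1+_]; -_; _+_; _-_; _*_; _^_; ∣_∣; 0ℤ; 1ℤ)
open import Data.Integer.GCD using (gcd)
open import Data.Integer.Properties using (^-*-assoc; pos-+; pos-*; +-injective; +-0-abelianGroup)
open import Algebra.Properties.Group (AbelianGroup.group +-0-abelianGroup) using (//-rightDividesˡ)
open import Data.Product using (Σ; _×_; _,_; proj₁; proj₂)
open import Data.Sum using (_⊎_; [_,_]′)
open import Relation.Nullary using (¬_; Dec)
open import Relation.Nullary.Decidable using (toWitness; _→-dec_; _×-dec_)
open import Relation.Binary.PropositionalEquality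
  using (_≡_; _≢_; refl; sym; trans; cong; cong₂; module ≡-Reasoning)

open ≡-Reasoning

%-distribˡ-^ : ∀ m n d .{{_ : NonZero d}} → m ℕ.^ n % d ≡ (m % d) ℕ.^ n % d
%-distribˡ-^ m ℕ.zero    d = refl
%-distribˡ-^ m (ℕ.suc n) d = begin
  m ℕ.* m ℕ.^ n % d                          ≡⟨ %-distribˡ-* m (m ℕ.^ n) d ⟩
  m % d ℕ.* (m ℕ.^ n % d) % d                ≡⟨ cong (λ x → m % d ℕ.* x % d) (%-distribˡ-^ m n d) ⟩
  m % d ℕ.* ((m % d) ℕ.^ n % d) % d          ≡⟨ cong (λ x → x ℕ.* ((m % d) ℕ.^ n % d) % d) (m%n%n≡m%n m d) ⟨
  m % d % d ℕ.* ((m % d) ℕ.^ n % d) % d      ≡⟨ %-distribˡ-* (m % d) ((m % d) ℕ.^ n) d ⟨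
  m % d ℕ.* (m % d) ℕ.^ n % d                ∎

r^2+s^4≡3t^4⇒s,t-even : ∀ {r} → r < 8 → ∀ {s} → s < 8 → ∀ {t} → t < 8 →
  (r ℕ.^ 2 ℕ.+ s ℕ.^ 4) % 8 ≡ 3 ℕ.* t ℕ.^ 4 % 8 → s % 2 ≡ 0 × t % 2 ≡ 0
r^2+s^4≡3t^4⇒s,t-even = toWitness {a? = below8 λ r → below8 λ s → below8 λ t →
  ((r ℕ.^ 2 ℕ.+ s ℕ.^ 4) % 8 ℕ.≟ 3 ℕ.* t ℕ.^ 4 % 8) →-dec (s % 2 ℕ.≟ 0 ×-dec t % 2 ℕ.≟ 0)} _
  where
  below8 : {P : ℕ → Set} → (∀ x → Dec (P x)) → Dec (∀ {x} → x < 8 → P x)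
  below8 P? = ℕ.allUpTo? P? 8

n^2+e^4≡km^4⇒2∣e∧2∣m : ∀ k n e m → k % 8 ≡ 3 →
  n ℕ.^ 2 ℕ.+ e ℕ.^ 4 ≡ k ℕ.* m ℕ.^ 4 → (2 ∣ e) × (2 ∣ m)
n^2+e^4≡km^4⇒2∣e∧2∣m k n e m k≡3 eq = even e (proj₁ parities) , even m (proj₂ parities)
  where
  even : ∀ x → x % 8 % 2 ≡ 0 → 2 ∣ x
  even x x≡0 = m%n≡0⇒n∣m x 2 (trans (sym (m∣n⇒o%n%m≡o%m 2 8 x (divides 4 refl))) x≡0)
  reduced : ((n % 8) ℕ.^ 2 ℕ.+ (e % 8) ℕ.^ 4) % 8 ≡ 3 ℕ.* (m % 8) ℕ.^ 4 % 8
  reduced = begin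
    ((n % 8) ℕ.^ 2 ℕ.+ (e % 8) ℕ.^ 4) % 8                 ≡⟨ %-distribˡ-+ ((n % 8) ℕ.^ 2) ((e % 8) ℕ.^ 4) 8 ⟩
    ((n % 8) ℕ.^ 2 % 8 ℕ.+ (e % 8) ℕ.^ 4 % 8) % 8         ≡⟨ cong₂ (λ x y → (x ℕ.+ y) % 8) (%-distribˡ-^ n 2 8) (%-distribˡ-^ e 4 8) ⟨
    (n ℕ.^ 2 % 8 ℕ.+ e ℕ.^ 4 % 8) % 8                     ≡⟨ %-distribˡ-+ (n ℕ.^ 2) (e ℕ.^ 4) 8 ⟨
    (n ℕ.^ 2 ℕ.+ e ℕ.^ 4) % 8                             ≡⟨ cong (_% 8) eq ⟩
    k ℕ.* m ℕ.^ 4 % 8                                     ≡⟨ %-distribˡ-* k (m ℕ.^ 4) 8 ⟩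
    k % 8 ℕ.* (m ℕ.^ 4 % 8) % 8                           ≡⟨ cong₂ (λ x y → x ℕ.* y % 8) k≡3 (%-distribˡ-^ m 4 8) ⟩
    3 ℕ.* ((m % 8) ℕ.^ 4 % 8) % 8                         ≡⟨ %-distribˡ-* 3 ((m % 8) ℕ.^ 4) 8 ⟨
    3 ℕ.* (m % 8) ℕ.^ 4 % 8                               ∎
  parities : e % 8 % 2 ≡ 0 × m % 8 % 2 ≡ 0
  parities = r^2+s^4≡3t^4⇒s,t-even (m%n<n n 8) (m%n<n e 8) (m%n<n m 8) reduced

pos-^ : ∀ m n → + (m ℕ.^ n) ≡ (+ m) ^ n
pos-^ m ℕ.zero    = refl
pos-^ m (ℕ.suc n) = trans (pos-* m (m ℕ.^ n)) (cong (+ m *_) (pos-^ m n))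

i^2≡+∣i∣^2 : ∀ i → i ^ 2 ≡ + (∣ i ∣ ℕ.^ 2)
i^2≡+∣i∣^2 (+ n)     = sym (pos-^ n 2)
i^2≡+∣i∣^2 -[1+ n ] = refl

i^[2k]≡+∣i∣^[2k] : ∀ i k → i ^ (2 ℕ.* k) ≡ + (∣ i ∣ ℕ.^ (2 ℕ.* k))
i^[2k]≡+∣i∣^[2k] i k = begin
  i ^ (2 ℕ.* k)               ≡⟨ ^-*-assoc i 2 k ⟨
  (i ^ 2) ^ k                 ≡⟨ cong (_^ k) (i^2≡+∣i∣^2 i) ⟩
  (+ (∣ i ∣ ℕ.^ 2)) ^ k       ≡⟨ pos-^ (∣ i ∣ ℕ.^ 2) k ⟨
  + ((∣ i ∣ ℕ.^ 2) ℕ.^ k)     ≡⟨ cong +_ (ℕ.^-*-assoc ∣ i ∣ 2 k) ⟩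
  + (∣ i ∣ ℕ.^ (2 ℕ.* k))     ∎

∣N∣^2+∣e∣^4≡k∣M∣^4 : ∀ k N M e → N ^ 2 ≡ + k * M ^ 4 - e ^ 4 →
  ∣ N ∣ ℕ.^ 2 ℕ.+ ∣ e ∣ ℕ.^ 4 ≡ k ℕ.* ∣ M ∣ ℕ.^ 4
∣N∣^2+∣e∣^4≡k∣M∣^4 k N M e eq = +-injective (begin
  + (∣ N ∣ ℕ.^ 2 ℕ.+ ∣ e ∣ ℕ.^ 4)          ≡⟨ pos-+ (∣ N ∣ ℕ.^ 2) (∣ e ∣ ℕ.^ 4) ⟩
  + (∣ N ∣ ℕ.^ 2) + + (∣ e ∣ ℕ.^ 4)        ≡⟨ cong₂ _+_ (i^2≡+∣i∣^2 N) (i^[2k]≡+∣i∣^[2k] e 2) ⟨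
  N ^ 2 + e ^ 4                            ≡⟨ cong (_+ e ^ 4) eq ⟩
  + k * M ^ 4 - e ^ 4 + e ^ 4              ≡⟨ //-rightDividesˡ (e ^ 4) (+ k * M ^ 4) ⟩
  + k * M ^ 4                              ≡⟨ cong (+ k *_) (i^[2k]≡+∣i∣^[2k] M 2) ⟩
  + k * + (∣ M ∣ ℕ.^ 4)                    ≡⟨ pos-* k (∣ M ∣ ℕ.^ 4) ⟨
  + (k ℕ.* ∣ M ∣ ℕ.^ 4)                    ∎)

5p%8≡3 : ∀ p → p % 40 ≡ 7 ⊎ p % 40 ≡ 23 → 5 ℕ.* p % 8 ≡ 3
5p%8≡3 p p≡7∨23 = trans (%-distribˡ-* 5 p 8) (cong (λ x → 5 ℕ.* x % 8) p≡7)
  where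
  p≡7 : p % 8 ≡ 7
  p≡7 = trans (sym (m∣n⇒o%n%m≡o%m 8 40 p (divides 5 refl)))
              ([ cong (_% 8) , cong (_% 8) ]′ p≡7∨23)

lemma3p1 : (p : ℕ) → Prime p → (p % 40 ≡ 7 ⊎ p % 40 ≡ 23) →
    ¬ (Σ ℤ λ N → Σ ℤ λ M → Σ ℤ λ e →
         M ≢ 0ℤ × e ≢ 0ℤ
         × N ^ 2 ≡ (+ 5 * + p) * M ^ 4 - e ^ 4
         × gcd N e ≡ 1ℤ × gcd M e ≡ 1ℤ × gcd (+ 5 * + p) e ≡ 1ℤ
         × gcd (- 1ℤ) M ≡ 1ℤ × gcd M N ≡ 1ℤ)
lemma3p1 p _ p≡7∨23 (N , M , e , _ , _ , eq , _ , gcd[M,e]≡1 , _) =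
  2≢1 (gcd≡1⇒coprime (+-injective gcd[M,e]≡1) (proj₂ evens , proj₁ evens))
  where
  2≢1 : 2 ≢ 1
  2≢1 ()
  eqℕ : ∣ N ∣ ℕ.^ 2 ℕ.+ ∣ e ∣ ℕ.^ 4 ≡ 5 ℕ.* p ℕ.* ∣ M ∣ ℕ.^ 4
  eqℕ = ∣N∣^2+∣e∣^4≡k∣M∣^4 (5 ℕ.* p) N M e
          (trans eq (cong (λ c → c * M ^ 4 - e ^ 4) (sym (pos-* 5 p))))
  evens : (2 ∣ ∣ e ∣) × (2 ∣ ∣ M ∣)
  evens = n^2+e^4≡km^4⇒2∣e∧2∣m (5 ℕ.* p) (∣ N ∣) (∣ e ∣) (∣ M ∣) (5p%8≡3 p p≡7∨23) eqℕ
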